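{- Let $u$ be a vertex of a graph $G$. Then $u$ is avoidable in $G$ if and only if $H_u[X]$ is a clique, where $H_u=H_u(X,C)$ is the filled-contracted graph of $u$.
   Context: All graphs are finite, simple and undirected. A vertex $v$ of a graph $G$ is avoidable if every induced path on three vertices with middle vertex $v$ is contained in an induced cycle of $G$. For a vertex $u$, $G_u(X,C)$ is the graph obtained from $G$ by contracting every connected component $K$ of $G-N_G[u]$ into a single new vertex adjacent exactly to the vertices outside $K$ having a neighbor in $K$; here $X=N_G(u)$ and $C$ is the set of contracted vertices. The filled-contracted graph $H_u(X,C)$ is obtained from $G_u(X,C)$ by adding edges so that for every $c\in C$ the neighborhood of $c$ becomes a clique. -}

module Defs where

open import Data.Nat using (ℕ; zero; suc; _≤_)
open import Data.Fin using (Fin; toℕ)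
open import Data.Product using (Σ; ∃; ∃-syntax; _×_; _,_)
open import Data.Sum using (_⊎_; inj₁; inj₂)
open import Data.Empty using (⊥)
open import Data.Unit using (⊤)
open import Relation.Nullary using (¬_; Dec)
open import Relation.Binary.PropositionalEquality using (_≡_; _≢_)
open import Function.Definitions using (Injective)
open import Function.Bundles using (_⇔_)

record Graph (n : ℕ) : Set₁ where
  field
    Adj    : Fin n → Fin n → Set
    adj?   : ∀ a b → Dec (Adj a b)
    sym    : ∀ {a b} → Adj a b → Adj b a
    irrefl : ∀ {a} → ¬ Adj a a

open Graph public

module _ {n : ℕ} (G : Graph n) where

  CycAdj : (k : ℕ) → Fin k → Fin k → Set
  CycAdj k i j = (suc (toℕ i) ≡ toℕ j) ⊎ (suc (toℕ j) ≡ toℕ i)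
               ⊎ ((toℕ i ≡ 0) × (suc (toℕ j) ≡ k))
               ⊎ ((toℕ j ≡ 0) × (suc (toℕ i) ≡ k))

  record InducedCycle : Set where
    field
      len    : ℕ
      len≥3  : 3 ≤ len
      vtx    : Fin len → Fin n
      inj    : Injective _≡_ _≡_ vtx
      induced : ∀ i j → (Adj G (vtx i) (vtx j) ⇔ CycAdj len i j)

  open InducedCycle public

  OnCycle : InducedCycle → Fin n → Set
  OnCycle c v = ∃[ i ] (vtx c i ≡ v)

  -- An induced path on three vertices x - v - y (middle vertex v) is contained
  -- in an induced cycle C.  Since C is an induced subgraph of G, the path is a
  -- subgraph of C exactly when its three vertices lie on C.
  PathInCycle : Fin n → Fin n → Fin n → InducedCycle → Set
  PathInCycle x v y c = OnCycle c x × OnCycle c v × OnCycle c y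

  Avoidable : Fin n → Set
  Avoidable v = ∀ x y → Adj G v x → Adj G v y → x ≢ y → ¬ Adj G x y →
                Σ InducedCycle (PathInCycle x v y)

  InClosedNbhd : Fin n → Fin n → Set
  InClosedNbhd u v = (v ≡ u) ⊎ Adj G u v

  data Reach (u : Fin n) : Fin n → Fin n → Set where
    here : ∀ {a} → ¬ InClosedNbhd u a → Reach u a a
    step : ∀ {a b c} → Reach u a b → Adj G b c → ¬ InClosedNbhd u c → Reach u a c

  -- Vertices of G_u(X,C): a vertex of N[u] (inj₁), or the contracted vertex
  -- of the component of G - N[u] containing a representative w (inj₂).
  -- Two representatives denote the same contracted vertex iff Reach u w w'.
  GuVertex : Fin n → Set
  GuVertex u = (Σ (Fin n) (InClosedNbhd u)) ⊎ (Σ (Fin n) (λ w → ¬ InClosedNbhd u w))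

  GuEq : (u : Fin n) → GuVertex u → GuVertex u → Set
  GuEq u (inj₁ (a , _)) (inj₁ (b , _)) = a ≡ b
  GuEq u (inj₁ _)       (inj₂ _)       = ⊥
  GuEq u (inj₂ _)       (inj₁ _)       = ⊥
  GuEq u (inj₂ (w , _)) (inj₂ (w' , _)) = Reach u w w'

  NbrInComp : Fin n → Fin n → Fin n → Set
  NbrInComp u a w = ∃[ z ] (Reach u w z × Adj G a z)

  GuAdj : (u : Fin n) → GuVertex u → GuVertex u → Set
  GuAdj u (inj₁ (a , _)) (inj₁ (b , _)) = Adj G a b
  GuAdj u (inj₁ (a , _)) (inj₂ (w , _)) = NbrInComp u a w
  GuAdj u (inj₂ (w , _)) (inj₁ (a , _)) = NbrInComp u a w
  GuAdj u (inj₂ _)       (inj₂ _)       = ⊥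

  IsContracted : (u : Fin n) → GuVertex u → Set
  IsContracted u (inj₁ _) = ⊥
  IsContracted u (inj₂ _) = ⊤

  HuAdj : (u : Fin n) → GuVertex u → GuVertex u → Set
  HuAdj u p q = GuAdj u p q
              ⊎ (¬ GuEq u p q × ∃[ c ] (IsContracted u c × GuAdj u c p × GuAdj u c q))

  -- X = N(u) as vertices of H_u.
  xVertex : (u x : Fin n) → Adj G u x → GuVertex u
  xVertex u x ux = inj₁ (x , inj₂ ux)

  HuXClique : Fin n → Set
  HuXClique u = ∀ x y (ux : Adj G u x) (uy : Adj G u y) → x ≢ y →
                HuAdj u (xVertex u x ux) (xVertex u y uy)

-- For distinct x, y ∈ N(u), H_u has the edge xy iff x ~ y or some component K of G − N[u]
-- contains neighbours of both.  Given such a K, a walk x → K → y shortened to an induced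
-- path has its interior outside N[u], so adding u closes it into an induced cycle through
-- x − u − y.  Conversely, on an induced cycle through x − u − y with x ≁ y, the remaining
-- vertices avoid N[u] and form a path, hence lie in one component adjacent to x and to y.

module Submission where

open import Defs
open import Data.Nat using (ℕ; zero; suc; _≤_; z≤n; s≤s)
open import Data.Nat.Properties using (suc-injective; 0≢1+n; 1+n≰n; <-irrefl; <⇒≤; ≤-refl; m≤n⇒m≤1+n)
import Data.Nat.Properties as ℕ
open import Data.Fin using (Fin; zero; suc; toℕ; fromℕ; fromℕ<; inject₁; lower₁)
open import Data.Fin.Properties
  using (toℕ-injective; toℕ-fromℕ; toℕ-fromℕ<; toℕ-inject₁; toℕ-inject₁-≢; toℕ-lower₁; toℕ<n; _≟_)
open import Data.List using (List; []; _∷_; length; lookup)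
open import Data.List.Relation.Unary.All as All using (All; []; _∷_)
open import Data.List.Relation.Unary.All.Properties using (¬Any⇒All¬)
open import Data.List.Relation.Unary.Any using (Any; here; there; any?)
open import Data.List.Membership.Propositional.Properties using (∈-lookup)
open import Data.Product using (Σ; ∃; _×_; _,_)
open import Data.Sum using (_⊎_; inj₁; inj₂)
import Data.Sum as Sum
open import Data.Empty using (⊥-elim)
open import Data.Unit using (tt)
open import Function using (_∘_)
open import Function.Bundles using (_⇔_; mk⇔; Equivalence)
import Function.Properties.Equivalence as ⇔
open import Function.Definitions using (Injective)
open import Relation.Nullary using (¬_; Dec; yes; no)
open import Relation.Nullary.Decidable using (_⊎-dec_)
open import Relation.Binary.PropositionalEquality as ≡ using (_≡_; _≢_; refl; cong; subst; trans)
open import Relation.Binary.Construct.Closure.ReflexiveTransitive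
  using (Star; ε; _◅_; _◅◅_; reverse; return)
import Relation.Binary.Construct.Closure.ReflexiveTransitive as Star

open Equivalence using (to; from)

Consecutive : ℕ → ℕ → Set
Consecutive i j = suc i ≡ j ⊎ suc j ≡ i

EndIndex : (k : ℕ) → Fin k → Set
EndIndex k i = toℕ i ≡ 0 ⊎ suc (toℕ i) ≡ k

cycSuc : ∀ {m} → Fin (suc m) → Fin (suc m)
cycSuc {m} i with m ℕ.≟ toℕ i
... | yes _   = zero
... | no m≢i = suc (lower₁ i m≢i)

cycSuc-cases : ∀ {m} (i : Fin (suc m)) →
               (toℕ i ≡ m × cycSuc i ≡ zero) ⊎ (toℕ i ≢ m × toℕ (cycSuc i) ≡ suc (toℕ i))
cycSuc-cases {m} i with m ℕ.≟ toℕ i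
... | yes m≡i = inj₁ (≡.sym m≡i , refl)
... | no m≢i  = inj₂ (m≢i ∘ ≡.sym , cong suc (toℕ-lower₁ i m≢i))

cycSuc-last : ∀ {m} {i : Fin (suc m)} → toℕ i ≡ m → cycSuc i ≡ zero
cycSuc-last {i = i} i≡m with cycSuc-cases i
... | inj₁ (_ , c≡0)  = c≡0
... | inj₂ (i≢m , _) = ⊥-elim (i≢m i≡m)

cycSuc-inject₁ : ∀ {m} (j : Fin m) → cycSuc (inject₁ j) ≡ suc j
cycSuc-inject₁ j with cycSuc-cases (inject₁ j)
... | inj₁ (j≡m , _) = ⊥-elim (toℕ-inject₁-≢ j (≡.sym j≡m))
... | inj₂ (_ , t)   = toℕ-injective (trans t (cong suc (toℕ-inject₁ j)))

cycSuc-surjective : ∀ {m} (j : Fin (suc m)) → ∃ λ i → cycSuc i ≡ j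
cycSuc-surjective {m} zero = fromℕ m , cycSuc-last (toℕ-fromℕ m)
cycSuc-surjective (suc j)  = inject₁ j , cycSuc-inject₁ j

cycSuc-injective : ∀ {m} → Injective _≡_ _≡_ (cycSuc {m})
cycSuc-injective {x = i} {j} e with cycSuc-cases i | cycSuc-cases j
... | inj₁ (i≡m , _)  | inj₁ (j≡m , _)  = toℕ-injective (trans i≡m (≡.sym j≡m))
... | inj₂ (_ , ti)   | inj₂ (_ , tj)   =
  toℕ-injective (suc-injective (trans (≡.sym ti) (trans (cong toℕ e) tj)))
... | inj₁ (_ , ci)   | inj₂ (_ , tj)   = ⊥-elim (0≢1+n (trans (cong toℕ (trans (≡.sym ci) e)) tj))
... | inj₂ (_ , ti)   | inj₁ (_ , cj)   = ⊥-elim (0≢1+n (trans (cong toℕ (trans (≡.sym cj) (≡.sym e))) ti))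

-- CycAdj G ignores G; Defs merely declares it inside the module parametrised by G.
module _ {n : ℕ} (G : Graph n) where

  CycAdj-sym : ∀ {k i j} → CycAdj G k i j → CycAdj G k j i
  CycAdj-sym (inj₁ e)                 = inj₂ (inj₁ e)
  CycAdj-sym (inj₂ (inj₁ e))          = inj₁ e
  CycAdj-sym (inj₂ (inj₂ (inj₁ e)))   = inj₂ (inj₂ (inj₂ e))
  CycAdj-sym (inj₂ (inj₂ (inj₂ e)))   = inj₂ (inj₂ (inj₁ e))

  CycAdj-zero-zero : ∀ {k} → ¬ CycAdj G (suc (suc k)) zero zero
  CycAdj-zero-zero (inj₁ ())
  CycAdj-zero-zero (inj₂ (inj₁ ()))
  CycAdj-zero-zero (inj₂ (inj₂ (inj₁ (_ , ()))))
  CycAdj-zero-zero (inj₂ (inj₂ (inj₂ (_ , ()))))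

  CycAdj-zero-suc : ∀ {k} {j : Fin k} → CycAdj G (suc k) zero (suc j) ⇔ EndIndex k j
  CycAdj-zero-suc = mk⇔ to′ from′
    where
    to′ : ∀ {k} {j : Fin k} → CycAdj G (suc k) zero (suc j) → EndIndex k j
    to′ (inj₁ e)                       = inj₁ (≡.sym (suc-injective e))
    to′ (inj₂ (inj₂ (inj₁ (_ , e))))   = inj₂ (suc-injective e)
    to′ (inj₂ (inj₁ ()))
    to′ (inj₂ (inj₂ (inj₂ (() , _))))
    from′ : ∀ {k} {j : Fin k} → EndIndex k j → CycAdj G (suc k) zero (suc j)
    from′ (inj₁ e) = inj₁ (cong suc (≡.sym e))
    from′ (inj₂ e) = inj₂ (inj₂ (inj₁ (refl , cong suc e)))

  CycAdj-suc-suc : ∀ {k} {i j : Fin k} → CycAdj G (suc k) (suc i) (suc j) ⇔ Consecutive (toℕ i) (toℕ j)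
  CycAdj-suc-suc = mk⇔ to′ (Sum.map (cong suc) (inj₁ ∘ cong suc))
    where
    to′ : ∀ {k} {i j : Fin k} → CycAdj G (suc k) (suc i) (suc j) → Consecutive (toℕ i) (toℕ j)
    to′ (inj₁ e)                     = inj₁ (suc-injective e)
    to′ (inj₂ (inj₁ e))              = inj₂ (suc-injective e)
    to′ (inj₂ (inj₂ (inj₁ (() , _))))
    to′ (inj₂ (inj₂ (inj₂ (() , _))))

  CycAdj-cycSuc : ∀ {m} (i : Fin (suc m)) → CycAdj G (suc m) i (cycSuc i)
  CycAdj-cycSuc i with cycSuc-cases i
  ... | inj₁ (i≡m , c≡0) = inj₂ (inj₂ (inj₂ (cong toℕ c≡0 , cong suc i≡m)))
  ... | inj₂ (_ , t)     = inj₁ (≡.sym t)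

  CycAdj⇔cycSuc : ∀ {m} {i j : Fin (suc m)} → CycAdj G (suc m) i j ⇔ (j ≡ cycSuc i ⊎ i ≡ cycSuc j)
  CycAdj⇔cycSuc = mk⇔ to′ from′
    where
    succeeds : ∀ {m} {i j : Fin (suc m)} → suc (toℕ i) ≡ toℕ j → j ≡ cycSuc i
    succeeds {i = i} {j} e with cycSuc-cases i
    ... | inj₁ (i≡m , _) = ⊥-elim (<-irrefl (trans (≡.sym e) (cong suc i≡m)) (toℕ<n j))
    ... | inj₂ (_ , t)   = toℕ-injective (trans (≡.sym e) (≡.sym t))
    wraps : ∀ {m} {i j : Fin (suc m)} → toℕ i ≡ 0 → suc (toℕ j) ≡ suc m → i ≡ cycSuc j
    wraps i≡0 e = toℕ-injective (trans i≡0 (cong toℕ (≡.sym (cycSuc-last (suc-injective e)))))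
    to′ : ∀ {m} {i j : Fin (suc m)} → CycAdj G (suc m) i j → j ≡ cycSuc i ⊎ i ≡ cycSuc j
    to′ (inj₁ e)                       = inj₁ (succeeds e)
    to′ (inj₂ (inj₁ e))                = inj₂ (succeeds e)
    to′ (inj₂ (inj₂ (inj₁ (i≡0 , e)))) = inj₂ (wraps i≡0 e)
    to′ (inj₂ (inj₂ (inj₂ (j≡0 , e)))) = inj₁ (wraps j≡0 e)
    from′ : ∀ {m} {i j : Fin (suc m)} → j ≡ cycSuc i ⊎ i ≡ cycSuc j → CycAdj G (suc m) i j
    from′ {i = i} (inj₁ refl) = CycAdj-cycSuc i
    from′ {j = j} (inj₂ refl) = CycAdj-sym (CycAdj-cycSuc j)

  CycAdj-rotate : ∀ {m} {i j : Fin (suc m)} → CycAdj G (suc m) i j ⇔ CycAdj G (suc m) (cycSuc i) (cycSuc j)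
  CycAdj-rotate =
    mk⇔ (from CycAdj⇔cycSuc ∘ Sum.map (cong cycSuc) (cong cycSuc) ∘ to CycAdj⇔cycSuc)
        (from CycAdj⇔cycSuc ∘ Sum.map cycSuc-injective cycSuc-injective ∘ to CycAdj⇔cycSuc)

  record IsInducedCycle (k : ℕ) (f : Fin k → Fin n) : Set where
    field
      injective : Injective _≡_ _≡_ f
      adjacency : ∀ i j → Adj G (f i) (f j) ⇔ CycAdj G k i j

  open IsInducedCycle

  isInducedCycle : (c : InducedCycle G) → IsInducedCycle (len c) (vtx c)
  isInducedCycle c = record { injective = inj c ; adjacency = induced c }

  rotate : ∀ {m} {f : Fin (suc m) → Fin n} → IsInducedCycle (suc m) f → IsInducedCycle (suc m) (f ∘ cycSuc)
  rotate c = record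
    { injective = cycSuc-injective ∘ injective c
    ; adjacency = λ i j → ⇔.trans (adjacency c (cycSuc i) (cycSuc j)) (⇔.sym CycAdj-rotate)
    }

  record Rerooted {m} (f : Fin (suc m) → Fin n) (a : Fin (suc m)) : Set where
    field
      vertex   : Fin (suc m) → Fin n
      isCycle  : IsInducedCycle (suc m) vertex
      root     : vertex zero ≡ f a
      contains : ∀ i → ∃ λ j → vertex j ≡ f i

  reroot : ∀ {m} {f : Fin (suc m) → Fin n} → IsInducedCycle (suc m) f → (a : Fin (suc m)) → Rerooted f a
  reroot c a = rerootAfter c (toℕ a) a refl
    where
    rerootAfter : ∀ {m} {f : Fin (suc m) → Fin n} → IsInducedCycle (suc m) f →
                  ∀ k (a : Fin (suc m)) → toℕ a ≡ k → Rerooted f a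
    rerootAfter c zero zero _ = record { vertex = _ ; isCycle = c ; root = refl ; contains = λ i → i , refl }
    rerootAfter {f = f} c (suc k) (suc b) e = record
      { vertex   = vertex r
      ; isCycle  = isCycle r
      ; root     = trans (root r) (cong f (cycSuc-inject₁ b))
      ; contains = contains′
      }
      where
      r : Rerooted (f ∘ cycSuc) (inject₁ b)
      r = rerootAfter (rotate c) k (inject₁ b) (trans (toℕ-inject₁ b) (suc-injective e))
      open Rerooted
      contains′ : ∀ i → ∃ λ j → vertex r j ≡ f i
      contains′ i with cycSuc-surjective i
      ... | i′ , i′↦i with contains r i′
      ...   | j , ej = j , trans ej (cong f i′↦i)

  SharedComponent : Fin n → Fin n → Fin n → Set
  SharedComponent u x y = ∃ λ w → ¬ InClosedNbhd G u w × NbrInComp G u x w × NbrInComp G u y w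

  SharedComponent-swap : ∀ {u x y} → SharedComponent u x y → SharedComponent u y x
  SharedComponent-swap (w , w∉N[u] , x~K , y~K) = w , w∉N[u] , y~K , x~K

  -- Positions 2, …, L − 2 of a cycle of length L avoid N[g 0] and are consecutive.
  sharedComponent-arc : ∀ {m} {g : Fin (suc (suc (suc (suc m)))) → Fin n} → IsInducedCycle _ g →
                        SharedComponent (g zero) (g (suc zero)) (g (fromℕ (suc (suc (suc m)))))
  sharedComponent-arc {m} {g} c =
    g (arc 0 z≤n) , outside 0 z≤n ,
    (g (arc 0 z≤n) , here (outside 0 z≤n) , first~arc) ,
    (g (arc m ≤-refl) , reach m ≤-refl , last~arc)
    where
    inner : ∀ t → t ≤ m → Fin (suc (suc (suc m)))
    inner t t≤m = suc (fromℕ< (s≤s (m≤n⇒m≤1+n t≤m)))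

    toℕ-inner : ∀ t (t≤m : t ≤ m) → toℕ (inner t t≤m) ≡ suc t
    toℕ-inner t t≤m = cong suc (toℕ-fromℕ< (s≤s (m≤n⇒m≤1+n t≤m)))

    arc : ∀ t → t ≤ m → Fin (suc (suc (suc (suc m))))
    arc t t≤m = suc (inner t t≤m)

    consecutive⇒adj : ∀ {i j} → Consecutive (toℕ i) (toℕ j) → Adj G (g (suc i)) (g (suc j))
    consecutive⇒adj i~j = from (adjacency c _ _) (from CycAdj-suc-suc i~j)

    outside : ∀ t (t≤m : t ≤ m) → ¬ InClosedNbhd G (g zero) (g (arc t t≤m))
    outside t t≤m (inj₁ e) with injective c e
    ... | ()
    outside t t≤m (inj₂ a) with to CycAdj-zero-suc (to (adjacency c zero (arc t t≤m)) a)
    ... | inj₁ ()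
    ... | inj₂ e = 1+n≰n (subst (_≤ m) (suc-injective (trans (≡.sym (toℕ-inner t t≤m)) (suc-injective e))) t≤m)

    reach : ∀ t (t≤m : t ≤ m) → Reach G (g zero) (g (arc 0 z≤n)) (g (arc t t≤m))
    reach zero    _     = here (outside 0 z≤n)
    reach (suc t) 1+t≤m = step (reach t t≤m)
      (consecutive⇒adj (inj₁ (trans (cong suc (toℕ-inner t t≤m)) (≡.sym (toℕ-inner (suc t) 1+t≤m)))))
      (outside (suc t) 1+t≤m)
      where t≤m = <⇒≤ 1+t≤m

    first~arc : Adj G (g (suc zero)) (g (arc 0 z≤n))
    first~arc = consecutive⇒adj (inj₁ (≡.sym (toℕ-inner 0 z≤n)))

    last~arc : Adj G (g (fromℕ (suc (suc (suc m))))) (g (arc m ≤-refl))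
    last~arc = consecutive⇒adj (inj₂ (trans (cong suc (toℕ-inner m ≤-refl)) (≡.sym (toℕ-fromℕ (suc (suc m))))))

  sharedComponent-ends : ∀ {m} {g : Fin (suc m) → Fin n} {i j : Fin m} → IsInducedCycle (suc m) g →
    toℕ i ≡ 0 → suc (toℕ j) ≡ m → g (suc i) ≢ g (suc j) → ¬ Adj G (g (suc i)) (g (suc j)) →
    SharedComponent (g zero) (g (suc i)) (g (suc j))
  sharedComponent-ends {suc zero} {i = zero} {zero} _ _ _ x≢y _ = ⊥-elim (x≢y refl)
  sharedComponent-ends {suc (suc zero)} {i = zero} {suc zero} c _ _ _ ¬xy =
    ⊥-elim (¬xy (from (adjacency c _ _) (inj₁ refl)))
  sharedComponent-ends {suc (suc (suc m))} {i = zero} {j} c _ e _ _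
    with toℕ-injective {j = fromℕ (suc (suc m))} (trans (suc-injective e) (≡.sym (toℕ-fromℕ _)))
  ... | refl = sharedComponent-arc c

  sharedComponent-at-zero : ∀ {m} {g : Fin (suc m) → Fin n} {i j u x y} → IsInducedCycle (suc m) g →
    g zero ≡ u → g i ≡ x → g j ≡ y →
    Adj G u x → Adj G u y → x ≢ y → ¬ Adj G x y → SharedComponent u x y
  sharedComponent-at-zero {i = zero} _ refl refl refl ux _ _ _ = ⊥-elim (irrefl G ux)
  sharedComponent-at-zero {j = zero} _ refl refl refl _ uy _ _ = ⊥-elim (irrefl G uy)
  sharedComponent-at-zero {g = g} {suc i} {suc j} c refl refl refl ux uy x≢y ¬xy
    with to CycAdj-zero-suc (to (adjacency c _ _) ux) | to CycAdj-zero-suc (to (adjacency c _ _) uy)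
  ... | inj₁ i≡0 | inj₁ j≡0 = ⊥-elim (x≢y (cong (g ∘ suc) (toℕ-injective (trans i≡0 (≡.sym j≡0)))))
  ... | inj₂ i≡m | inj₂ j≡m = ⊥-elim (x≢y (cong (g ∘ suc) (toℕ-injective (suc-injective (trans i≡m (≡.sym j≡m))))))
  ... | inj₁ i≡0 | inj₂ j≡m = sharedComponent-ends c i≡0 j≡m x≢y ¬xy
  ... | inj₂ i≡m | inj₁ j≡0 = SharedComponent-swap (sharedComponent-ends c j≡0 i≡m (x≢y ∘ ≡.sym) (¬xy ∘ sym G))

  sharedComponent : ∀ {k} {f : Fin k → Fin n} {a i j u x y} → IsInducedCycle k f →
    f a ≡ u → f i ≡ x → f j ≡ y →
    Adj G u x → Adj G u y → x ≢ y → ¬ Adj G x y → SharedComponent u x y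
  sharedComponent {zero} {a = ()}
  sharedComponent {suc m} {a = a} {i} {j} c au ix jy with reroot c a
  ... | record { isCycle = c′ ; root = root ; contains = contains } with contains i | contains j
  ... | i′ , i′↦i | j′ , j′↦j = sharedComponent-at-zero c′ (trans root au) (trans i′↦i ix) (trans j′↦j jy)

  inClosedNbhd? : ∀ a z → Dec (InClosedNbhd G a z)
  inClosedNbhd? a z = (z ≟ a) ⊎-dec adj? G a z

  data InducedPath (y : Fin n) : List (Fin n) → Set where
    end    : InducedPath y (y ∷ [])
    extend : ∀ {a s S} → Adj G a s → All (λ z → ¬ InClosedNbhd G a z) S →
             InducedPath y (s ∷ S) → InducedPath y (a ∷ s ∷ S)

  lookup-injective : ∀ {y P} → InducedPath y P → Injective _≡_ _≡_ (lookup P)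
  lookup-injective end                {zero}        {zero}        _ = refl
  lookup-injective (extend _ _ _)     {zero}        {zero}        _ = refl
  lookup-injective (extend as _ _)    {zero}        {suc zero}    e = ⊥-elim (irrefl G (subst (Adj G _) (≡.sym e) as))
  lookup-injective (extend as _ _)    {suc zero}    {zero}        e = ⊥-elim (irrefl G (subst (Adj G _) e as))
  lookup-injective (extend _ far _)   {zero}        {suc (suc j)} e = ⊥-elim (All.lookup far (∈-lookup j) (inj₁ (≡.sym e)))
  lookup-injective (extend _ far _)   {suc (suc i)} {zero}        e = ⊥-elim (All.lookup far (∈-lookup i) (inj₁ e))
  lookup-injective (extend _ _ p)     {suc i}       {suc j}       e = cong suc (lookup-injective p e)

  lookup-adj⇔consecutive : ∀ {y P} → InducedPath y P →
    ∀ i j → Adj G (lookup P i) (lookup P j) ⇔ Consecutive (toℕ i) (toℕ j)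
  lookup-adj⇔consecutive p i j = mk⇔ (adj⇒consecutive p i j) (consecutive⇒adj p i j)
    where
    adj⇒consecutive : ∀ {y P} → InducedPath y P → ∀ i j → Adj G (lookup P i) (lookup P j) → Consecutive (toℕ i) (toℕ j)
    adj⇒consecutive end              zero          zero          a = ⊥-elim (irrefl G a)
    adj⇒consecutive (extend _ _ _)   zero          zero          a = ⊥-elim (irrefl G a)
    adj⇒consecutive (extend _ _ _)   zero          (suc zero)    _ = inj₁ refl
    adj⇒consecutive (extend _ _ _)   (suc zero)    zero          _ = inj₂ refl
    adj⇒consecutive (extend _ far _) zero          (suc (suc j)) a = ⊥-elim (All.lookup far (∈-lookup j) (inj₂ a))
    adj⇒consecutive (extend _ far _) (suc (suc i)) zero          a = ⊥-elim (All.lookup far (∈-lookup i) (inj₂ (sym G a)))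
    adj⇒consecutive (extend _ _ p)   (suc i)       (suc j)       a = Sum.map (cong suc) (cong suc) (adj⇒consecutive p i j a)
    consecutive⇒adj : ∀ {y P} → InducedPath y P → ∀ i j → Consecutive (toℕ i) (toℕ j) → Adj G (lookup P i) (lookup P j)
    consecutive⇒adj end             zero          zero          (inj₁ ())
    consecutive⇒adj end             zero          zero          (inj₂ ())
    consecutive⇒adj (extend _ _ _)  zero          zero          (inj₁ ())
    consecutive⇒adj (extend _ _ _)  zero          zero          (inj₂ ())
    consecutive⇒adj (extend as _ _) zero          (suc zero)    _ = as
    consecutive⇒adj (extend as _ _) (suc zero)    zero          _ = sym G as
    consecutive⇒adj (extend _ _ _)  zero          (suc (suc j)) (inj₁ ())
    consecutive⇒adj (extend _ _ _)  zero          (suc (suc j)) (inj₂ ())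
    consecutive⇒adj (extend _ _ _)  (suc (suc i)) zero          (inj₁ ())
    consecutive⇒adj (extend _ _ _)  (suc (suc i)) zero          (inj₂ ())
    consecutive⇒adj (extend _ _ p)  (suc i)       (suc j)       c =
      consecutive⇒adj p i j (Sum.map suc-injective suc-injective c)

  lookup-end : ∀ {y a Q} → InducedPath y (a ∷ Q) → lookup (a ∷ Q) (fromℕ (length Q)) ≡ y
  lookup-end end            = refl
  lookup-end (extend _ _ p) = lookup-end p

  closeInducedPath : ∀ {u y x R} → InducedPath y (x ∷ R) →
    (∀ i → lookup (x ∷ R) i ≢ u) →
    (∀ i → Adj G u (lookup (x ∷ R) i) ⇔ EndIndex (suc (length R)) i) →
    IsInducedCycle (suc (suc (length R))) (lookup (u ∷ x ∷ R))
  closeInducedPath {u = u} {x = x} {R = R} p ≢u u~end = record { injective = injective′ ; adjacency = adjacency′ }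
    where
    C : List (Fin n)
    C = u ∷ x ∷ R
    injective′ : Injective _≡_ _≡_ (lookup C)
    injective′ {zero}  {zero}  _ = refl
    injective′ {zero}  {suc j} e = ⊥-elim (≢u j (≡.sym e))
    injective′ {suc i} {zero}  e = ⊥-elim (≢u i e)
    injective′ {suc i} {suc j} e = cong suc (lookup-injective p e)
    u~ : ∀ j → Adj G u (lookup C (suc j)) ⇔ CycAdj G (length C) zero (suc j)
    u~ j = ⇔.trans (u~end j) (⇔.sym CycAdj-zero-suc)
    adjacency′ : ∀ i j → Adj G (lookup C i) (lookup C j) ⇔ CycAdj G (length C) i j
    adjacency′ zero    zero    = mk⇔ (⊥-elim ∘ irrefl G) (⊥-elim ∘ CycAdj-zero-zero)
    adjacency′ zero    (suc j) = u~ j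
    adjacency′ (suc i) zero    = mk⇔ (CycAdj-sym ∘ to (u~ i) ∘ sym G) (sym G ∘ from (u~ i) ∘ CycAdj-sym)
    adjacency′ (suc i) (suc j) = ⇔.trans (lookup-adj⇔consecutive p i j) (⇔.sym CycAdj-suc-suc)

  EdgeWithin : (Fin n → Set) → Fin n → Fin n → Set
  EdgeWithin W a b = W a × Adj G a b × W b

  EdgeWithin-sym : ∀ {W a b} → EdgeWithin W a b → EdgeWithin W b a
  EdgeWithin-sym (wa , ab , wb) = wb , sym G ab , wa

  record InducedPathWithin (W : Fin n → Set) (x y : Fin n) : Set where
    field
      rest   : List (Fin n)
      path   : InducedPath y (x ∷ rest)
      within : All W (x ∷ rest)

  open InducedPathWithin

  -- Cutting at the last vertex in N[a] is what lets a be prepended to the suffix.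
  suffixFromLast : ∀ {W y a P} → InducedPath y P → All W P → Any (InClosedNbhd G a) P →
    Σ (Fin n) λ s → InClosedNbhd G a s ×
      Σ (InducedPathWithin W s y) λ q → All (λ z → ¬ InClosedNbhd G a z) (rest q)
  suffixFromLast end ws (here near) = _ , near , record { rest = [] ; path = end ; within = ws } , []
  suffixFromLast {a = a} p@(extend {S = S} _ _ p′) ws@(_ ∷ ws′) near with any? (inClosedNbhd? a) (_ ∷ S)
  ... | yes nearLater = suffixFromLast p′ ws′ nearLater
  ... | no farLater   = _ , nearHead near , record { rest = _ ∷ S ; path = p ; within = ws } , ¬Any⇒All¬ _ farLater
    where
    nearHead : Any (InClosedNbhd G a) (_ ∷ _ ∷ S) → InClosedNbhd G a _
    nearHead (here h)  = h
    nearHead (there t) = ⊥-elim (farLater t)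

  shortenWalk : ∀ {W x y} → W x → Star (EdgeWithin W) x y → InducedPathWithin W x y
  shortenWalk wx ε = record { rest = [] ; path = end ; within = wx ∷ [] }
  shortenWalk wx ((_ , xb , wb) ◅ walk) with shortenWalk wb walk
  ... | q with suffixFromLast (path q) (within q) (here (inj₂ xb))
  ...   | _ , inj₁ refl , q′ , _   = q′
  ...   | s , inj₂ xs , q′ , far = record
          { rest = s ∷ rest q′ ; path = extend xs far (path q′) ; within = wx ∷ within q′ }

  reach-outside : ∀ {u a b} → Reach G u a b → ¬ InClosedNbhd G u b
  reach-outside (here b∉N[u])     = b∉N[u]
  reach-outside (step _ _ b∉N[u]) = b∉N[u]

  reach⇒walk : ∀ {u a b} → Reach G u a b → Star (EdgeWithin (λ v → ¬ InClosedNbhd G u v)) a b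
  reach⇒walk (here _)           = ε
  reach⇒walk (step r bc c∉N[u]) = reach⇒walk r ◅◅ return (reach-outside r , bc , c∉N[u])

  EndOrOutside : Fin n → Fin n → Fin n → Fin n → Set
  EndOrOutside u x y v = v ≡ x ⊎ v ≡ y ⊎ ¬ InClosedNbhd G u v

  closeThrough : ∀ {u x y} → Adj G u x → Adj G u y → x ≢ y →
            InducedPathWithin (EndOrOutside u x y) x y → Σ (InducedCycle G) (PathInCycle G x u y)
  closeThrough _ _ x≢y record { rest = [] ; path = end } = ⊥-elim (x≢y refl)
  closeThrough {u} {x} {y} ux uy _ record { rest = q ∷ Q ; path = p ; within = ws } =
    record { len = _ ; len≥3 = s≤s (s≤s (s≤s z≤n)) ; vtx = _ ; inj = injective c ; induced = adjacency c } ,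
    (suc zero , refl) , (zero , refl) , (suc (fromℕ (suc (length Q))) , lookup-end p)
    where
    P : List (Fin n)
    P = x ∷ q ∷ Q
    classify : ∀ i → EndOrOutside u x y (lookup P i)
    classify i = All.lookup ws (∈-lookup i)
    ≢u : ∀ i → lookup P i ≢ u
    ≢u i e with classify i
    ... | inj₁ e′        = irrefl G (subst (Adj G u) (trans (≡.sym e′) e) ux)
    ... | inj₂ (inj₁ e′) = irrefl G (subst (Adj G u) (trans (≡.sym e′) e) uy)
    ... | inj₂ (inj₂ o)  = o (inj₁ e)
    u~⇒end : ∀ i → Adj G u (lookup P i) → EndIndex (length P) i
    u~⇒end i a with classify i
    ... | inj₁ e        = inj₁ (cong toℕ (lookup-injective p {i} {zero} e))
    ... | inj₂ (inj₁ e) = inj₂ (cong suc (trans (cong toℕ (lookup-injective p (trans e (≡.sym (lookup-end p)))))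
                                                (toℕ-fromℕ (suc (length Q)))))
    ... | inj₂ (inj₂ o) = ⊥-elim (o (inj₂ a))
    end⇒u~ : ∀ i → EndIndex (length P) i → Adj G u (lookup P i)
    end⇒u~ zero    (inj₁ _) = ux
    end⇒u~ (suc i) (inj₁ ())
    end⇒u~ i       (inj₂ e) = subst (Adj G u) (≡.sym (trans (cong (lookup P) i≡last) (lookup-end p))) uy
      where
      i≡last : i ≡ fromℕ (suc (length Q))
      i≡last = toℕ-injective (trans (suc-injective e) (≡.sym (toℕ-fromℕ _)))
    c : IsInducedCycle (suc (length P)) (lookup (u ∷ P))
    c = closeInducedPath p ≢u (λ i → mk⇔ (u~⇒end i) (end⇒u~ i))

  sharedComponent⇒cycle : ∀ {u x y} → Adj G u x → Adj G u y → x ≢ y →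
                          SharedComponent u x y → Σ (InducedCycle G) (PathInCycle G x u y)
  sharedComponent⇒cycle {u} {x} {y} ux uy x≢y (_ , _ , (_ , r₁ , xz₁) , (_ , r₂ , yz₂)) =
    closeThrough ux uy x≢y (shortenWalk (inj₁ refl) walk)
    where
    outside : ∀ {v} → ¬ InClosedNbhd G u v → EndOrOutside u x y v
    outside = inj₂ ∘ inj₂
    widen : ∀ {a b} → EdgeWithin (λ v → ¬ InClosedNbhd G u v) a b → EdgeWithin (EndOrOutside u x y) a b
    widen (oa , ab , ob) = outside oa , ab , outside ob
    walk : Star (EdgeWithin (EndOrOutside u x y)) x y
    walk = (inj₁ refl , xz₁ , outside (reach-outside r₁))
         ◅ Star.map widen (reverse EdgeWithin-sym (reach⇒walk r₁) ◅◅ reach⇒walk r₂)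
         ◅◅ return (outside (reach-outside r₂) , sym G yz₂ , inj₂ (inj₁ refl))

  HuAdj-neighbours⇔ : ∀ {u x y} {ux : Adj G u x} {uy : Adj G u y} →
    HuAdj G u (xVertex G u x ux) (xVertex G u y uy) ⇔ (Adj G x y ⊎ (x ≢ y × SharedComponent u x y))
  HuAdj-neighbours⇔ = mk⇔ to′ from′
    where
    to′ : ∀ {u x y} {ux : Adj G u x} {uy : Adj G u y} →
          HuAdj G u (xVertex G u x ux) (xVertex G u y uy) → Adj G x y ⊎ (x ≢ y × SharedComponent u x y)
    to′ (inj₁ xy)                                     = inj₁ xy
    to′ (inj₂ (x≢y , inj₂ (w , w∉N[u]) , _ , x~K , y~K)) = inj₂ (x≢y , w , w∉N[u] , x~K , y~K)
    to′ (inj₂ (_ , inj₁ _ , () , _))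
    from′ : ∀ {u x y} {ux : Adj G u x} {uy : Adj G u y} →
            Adj G x y ⊎ (x ≢ y × SharedComponent u x y) → HuAdj G u (xVertex G u x ux) (xVertex G u y uy)
    from′ (inj₁ xy)                                = inj₁ xy
    from′ (inj₂ (x≢y , w , w∉N[u] , x~K , y~K)) = inj₂ (x≢y , inj₂ (w , w∉N[u]) , tt , x~K , y~K)

  avoidable⇒HuXClique : ∀ {u} → Avoidable G u → HuXClique G u
  avoidable⇒HuXClique av x y ux uy x≢y with adj? G x y
  ... | yes xy  = inj₁ xy
  ... | no ¬xy with av x y ux uy x≢y ¬xy
  ...   | c , (_ , cx) , (_ , cu) , (_ , cy) =
    from HuAdj-neighbours⇔ (inj₂ (x≢y , sharedComponent (isInducedCycle c) cu cx cy ux uy x≢y ¬xy))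

  HuXClique⇒avoidable : ∀ {u} → HuXClique G u → Avoidable G u
  HuXClique⇒avoidable cl x y ux uy x≢y ¬xy with to HuAdj-neighbours⇔ (cl x y ux uy x≢y)
  ... | inj₁ xy          = ⊥-elim (¬xy xy)
  ... | inj₂ (_ , share) = sharedComponent⇒cycle ux uy x≢y share

lemma24 : (n : ℕ) (G : Graph n) (u : Fin n) → (Avoidable G u ⇔ HuXClique G u)
lemma24 n G u = mk⇔ (avoidable⇒HuXClique G) (HuXClique⇒avoidable G)
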